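{- Let $n\ge1$ and $c\in\mathrm{Rec}_n$. Then the output of the reduction algorithm applied to $c$ is a permutation of the set $\{0,\dots,n-1\}$, and hence a minimal recurrent $n$-configuration.
   Context: Abelian sandpile model on the complete graph $K_n$: a configuration is $c=(c_1,\dots,c_n)\in\mathbb{Z}_{\ge0}^n$; vertex $i$ is stable if $c_i<n$, and $c$ is stable if all vertices are. Toppling an unstable vertex $i$ subtracts $n$ from $c_i$ and adds $1$ to every $c_j$, $j\ne i$ (one grain leaves the system). Repeatedly toppling unstable vertices yields a stable configuration $\mathrm{Stab}(c)$, independent of the order. Fix a probability distribution $\mu$ on $[n]$ with all $\mu_i>0$; the Markov chain on stable configurations adds a grain at vertex $i$ with probability $\mu_i$ and stabilises. $\mathrm{Rec}_n$ is the set of recurrent configurations of this chain (equivalently, by Dhar's burning criterion, stable $c$ such that $c+(1,\dots,1)$ admits a sequence of topplings in which every vertex topples exactly once; equivalently, by Cori–Rossin, $(n-c_1,\dots,n-c_n)$ is a parking function). Recurrent configurations are partially ordered componentwise; minimal elements are minimal recurrent configurations. Reduction algorithm on input $c$: repeat the following. (1) If the entries of $c$ are pairwise distinct, return $c$. Otherwise let $j=\min\{j'\in[n]: c_{j'}\in\{c_1,\dots,c_{j'-1}\}\}$ and let $i<j$ be the index with $c_i=c_j$. (2) While there exists $j'\in\{1,\dots,j\}\setminus\{i\}$ with $c_{j'}=c_i$, decrease $c_i$ by one. -}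

module Defs where

open import Data.Nat using (ℕ; zero; suc; _∸_; _≤_; _<_; NonZero)
open import Data.Nat.Properties using ()
open import Data.Fin using (Fin; toℕ; _≟_)
open import Data.List using (List; []; _∷_; allFin)
open import Data.List.Relation.Binary.Permutation.Propositional using (_↭_)
open import Data.Product using (Σ; ∃; _×_; _,_)
open import Relation.Binary.PropositionalEquality using (_≡_; _≢_)
open import Relation.Nullary using (yes; no)
open import Function.Definitions using (Injective; Bijective)

-- A configuration on the complete graph K_n (vertices indexed by Fin n, 0-based).
Config : ℕ → Set
Config n = Fin n → ℕ

_≤ᶜ_ : ∀ {n} → Config n → Config n → Set
c ≤ᶜ d = ∀ i → c i ≤ d i

Stable : ∀ {n} → Config n → Set
Stable {n} c = ∀ i → c i < n

topple : ∀ {n} → Fin n → Config n → Config n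
topple {n} i c k with k ≟ i
... | yes _ = c i ∸ n
... | no  _ = suc (c k)

data LegalSeq {n : ℕ} : Config n → List (Fin n) → Set where
  []  : ∀ {c} → LegalSeq c []
  _∷_ : ∀ {c i is} → n ≤ c i → LegalSeq (topple i c) is → LegalSeq c (i ∷ is)

addOnes : ∀ {n} → Config n → Config n
addOnes c k = suc (c k)

-- Recurrent configurations via Dhar's burning criterion: c is stable and
-- c + (1,…,1) admits a legal toppling sequence in which every vertex topples exactly once.
Rec : ∀ {n} → Config n → Set
Rec {n} c = Stable c × ∃ λ (is : List (Fin n)) → LegalSeq (addOnes c) is × (is ↭ allFin n)

MinimalRec : ∀ {n} → Config n → Set
MinimalRec {n} c = Rec c × (∀ (d : Config n) → Rec d → d ≤ᶜ c → ∀ i → d i ≡ c i)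

IsPermutation : ∀ {n} → Config n → Set
IsPermutation {n} c =
  ∃ λ (σ : Fin n → Fin n) → Bijective _≡_ _≡_ σ × (∀ i → c i ≡ toℕ (σ i))

Distinct : ∀ {n} → Config n → Set
Distinct c = Injective _≡_ _≡_ c

_[_≔_] : ∀ {n} → Config n → Fin n → ℕ → Config n
(c [ i ≔ v ]) k with k ≟ i
... | yes _ = v
... | no  _ = c k

-- Inner while-loop (step (2)) with fixed i, j:
-- "while ∃ j' ∈ {1..j}∖{i} with c_{j'} = c_i, decrease c_i by one".
-- Lower c i j c' : running the loop from c terminates in c' (never leaving ℕ;
-- a decrement below 0 has no derivation).
data Lower {n : ℕ} (i j : Fin n) : Config n → Config n → Set where
  stop : ∀ {c} →
         (∀ j' → toℕ j' ≤ toℕ j → j' ≢ i → c j' ≢ c i) →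
         Lower i j c c
  dec  : ∀ {c d v} (j' : Fin n) → toℕ j' ≤ toℕ j → j' ≢ i → c j' ≡ c i →
         c i ≡ suc v →
         Lower i j (c [ i ≔ v ]) d →
         Lower i j c d

FirstDuplicate : ∀ {n} → Config n → Fin n → Fin n → Set
FirstDuplicate c i j =
  toℕ i < toℕ j × c i ≡ c j ×
  (∀ (j' i' : Fin _) → toℕ j' < toℕ j → toℕ i' < toℕ j' → c i' ≢ c j')

data Reduce {n : ℕ} : Config n → Config n → Set where
  finish : ∀ {c} → Distinct c → Reduce c c
  step   : ∀ {c c' d} (i j : Fin n) → FirstDuplicate c i j →
           Lower i j c c' → Reduce c' d → Reduce c d

-- Lowering a duplicated entry never destroys the property that c lies pointwise above some
-- permutation of {0,…,n−1} (if needed, exchange the values of that permutation at the two equal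
-- entries), and for stable c this property is recurrence. It keeps every entry positive while it
-- still has a duplicate, so the inner loop stops, and the total number of grains drops in each
-- round, so the algorithm stops. Its output is stable with distinct entries, hence a permutation
-- of {0,…,n−1}; that is recurrent, and minimal because an injection Fin n → Fin n lying below a
-- bijection equals it.
module Submission where

open import Defs
open import Data.Nat.Base as ℕ using (ℕ; zero; suc; _+_; _∸_; _≤_; _<_)
import Data.Nat.Induction as ℕ
import Data.Nat.Properties as ℕ
import Data.Fin as Fin
open import Data.Fin using (Fin; toℕ; _≟_; fromℕ<; inject; cast; opposite; punchOut)
import Data.Fin.Properties as Fin
open import Data.Fin.Properties
  using (any?; all?; ¬∀⟶∃¬-smallest; injective⇒≤; punchOut-injective; 0≢1+n; toℕ-injective;
         toℕ-inject; toℕ-fromℕ<; toℕ-cast; toℕ<n; opposite-prop; opposite-involutive)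
open import Data.Fin.Induction using (<-wellFounded)
open import Data.Fin.Permutation.Components using (transpose; transpose-inverse)
open import Data.List.Base using (length; tabulate; allFin)
open import Data.List.Properties using (length-tabulate)
open import Data.List.Membership.Propositional using (_∈_)
open import Data.List.Membership.Propositional.Properties using (∈-tabulate⁺; ∈-allFin)
open import Data.List.Membership.Propositional.Properties.WithK using (unique∧set⇒bag)
open import Data.List.Membership.Setoid.Properties using (index-injective)
open import Data.List.Relation.Binary.BagAndSetEquality using (∼bag⇒↭)
open import Data.List.Relation.Binary.Permutation.Propositional using (_↭_; ↭-sym; ↭⇒↭ₛ)
open import Data.List.Relation.Binary.Permutation.Propositional.Properties using (∈-resp-↭; ↭-length)
open import Data.List.Relation.Binary.Permutation.Setoid.Properties using (Unique-resp-↭)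
import Data.List.Relation.Unary.All as All
open import Data.List.Relation.Unary.AllPairs using (_∷_)
open import Data.List.Relation.Unary.Any using (here; there; index)
open import Data.List.Relation.Unary.Unique.Propositional using (Unique)
open import Data.List.Relation.Unary.Unique.Propositional.Properties using (tabulate⁺; allFin⁺)
open import Data.Product.Base using (∃; ∃₂; _×_; _,_; proj₁; proj₂; map₂)
open import Data.Sum.Base using (_⊎_; inj₁; inj₂)
open import Function.Base using (_∘_; id)
open import Function.Bundles using (mk⇔)
open import Function.Definitions using (Injective; Surjective)
open import Induction.WellFounded using (Acc; acc)
open import Relation.Binary.Definitions using (tri<; tri≈; tri>)
open import Relation.Binary.PropositionalEquality
open import Relation.Nullary using (Dec; yes; no; ¬_; ¬?; _×-dec_; contradiction)
open import Relation.Nullary.Decidable using (dec-true; dec-false; decidable-stable)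
open import Relation.Unary using (Decidable)

injective⇒surjective : ∀ {n} {f : Fin n → Fin n} → Injective _≡_ _≡_ f → Surjective _≡_ _≡_ f
injective⇒surjective {suc n} {f} f-inj y with any? (λ x → f x ≟ y)
... | yes (x , fx≡y) = x , λ { refl → fx≡y }
... | no ∄x = contradiction (injective⇒≤ g-inj) ℕ.1+n≰n
  where
  y≢f : ∀ x → y ≢ f x
  y≢f x y≡fx = ∄x (x , sym y≡fx)
  g : Fin (suc n) → Fin n
  g x = punchOut (y≢f x)
  g-inj : Injective _≡_ _≡_ g
  g-inj {x} {x'} gx≡gx' = f-inj (punchOut-injective (y≢f x) (y≢f x') gx≡gx')

-- If π k < δ k, the δ-preimage of π k already agrees with π, contradicting injectivity of π.
injections-≤-coincide : ∀ {n} {π δ : Fin n → Fin n} →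
  Injective _≡_ _≡_ π → Injective _≡_ _≡_ δ → (∀ k → π k Fin.≤ δ k) → ∀ k → π k ≡ δ k
injections-≤-coincide {π = π} {δ} π-inj δ-inj π≤δ k = coincideAt (δ k) (<-wellFounded (δ k)) k refl
  where
  coincideAt : ∀ y → Acc Fin._<_ y → ∀ k → δ k ≡ y → π k ≡ y
  coincideAt y (acc smaller) k refl with ℕ.m≤n⇒m<n∨m≡n (π≤δ k)
  ... | inj₂ πk≡δk = toℕ-injective πk≡δk
  ... | inj₁ πk<δk with injective⇒surjective δ-inj (π k)
  ...   | k' , δk'≡πk = contradiction πk<δk (ℕ.<-irrefl (cong toℕ (sym (δk'≡πk (sym k'≡k)))))
    where
    k'≡k : k' ≡ k
    k'≡k = π-inj (coincideAt (π k) (smaller πk<δk) k' (δk'≡πk refl))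

opposite-injective : ∀ {n} → Injective _≡_ _≡_ (opposite {n})
opposite-injective {x = a} {b} eq =
  trans (sym (opposite-involutive a)) (trans (cong opposite eq) (opposite-involutive b))

injective⇒tabulate↭allFin : ∀ {n} {h : Fin n → Fin n} → Injective _≡_ _≡_ h → tabulate h ↭ allFin n
injective⇒tabulate↭allFin {n} {h} h-inj =
  ∼bag⇒↭ (unique∧set⇒bag (tabulate⁺ h-inj) (allFin⁺ n)
           λ {k} → mk⇔ (λ _ → ∈-allFin k) (λ _ → k∈tabulate k))
  where
  k∈tabulate : ∀ k → k ∈ tabulate h
  k∈tabulate k with x , hx≡k ← injective⇒surjective h-inj k = subst (_∈ tabulate h) (hx≡k refl) (∈-tabulate⁺ x)

transpose-matchˡ : ∀ {n} (i j : Fin n) → transpose i j i ≡ j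
transpose-matchˡ i j rewrite dec-true (i ≟ i) refl = refl

transpose-matchʳ : ∀ {n} (i j : Fin n) → transpose i j j ≡ i
transpose-matchʳ i j with j ≟ i
... | yes j≡i = j≡i
... | no _ rewrite dec-true (j ≟ j) refl = refl

transpose-other : ∀ {n} {i j k : Fin n} → k ≢ i → k ≢ j → transpose i j k ≡ k
transpose-other {i = i} {j} {k} k≢i k≢j
  rewrite dec-false (k ≟ i) k≢i | dec-false (k ≟ j) k≢j = refl

transpose-injective : ∀ {n} (i j : Fin n) → Injective _≡_ _≡_ (transpose i j)
transpose-injective i j {a} {b} eq =
  trans (sym (transpose-inverse j i)) (trans (cong (transpose j i) eq) (transpose-inverse j i))

update-same : ∀ {n} (c : Config n) i v → (c [ i ≔ v ]) i ≡ v
update-same c i v with i ≟ i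
... | yes _ = refl
... | no i≢i = contradiction refl i≢i

update-other : ∀ {n} (c : Config n) {i k} v → k ≢ i → (c [ i ≔ v ]) k ≡ c k
update-other c {i} {k} v k≢i with k ≟ i
... | yes k≡i = contradiction k≡i k≢i
... | no _ = refl

update-≤ᶜ : ∀ {n} (c : Config n) {i v} → v ≤ c i → (c [ i ≔ v ]) ≤ᶜ c
update-≤ᶜ c {i} v≤ci k with k ≟ i
... | yes refl = v≤ci
... | no _ = ℕ.≤-refl

topple-other : ∀ {n} (c : Config n) {i k} → k ≢ i → topple i c k ≡ suc (c k)
topple-other c {i} {k} k≢i with k ≟ i
... | yes k≡i = contradiction k≡i k≢i
... | no _ = refl

legalSeq⇒threshold : ∀ {n} {e : Config n} {ks} → LegalSeq e ks → Unique ks →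
  ∀ {k} (k∈ks : k ∈ ks) → n ≤ e k + toℕ (index k∈ks)
legalSeq⇒threshold (unstable ∷ _) _ (here refl) = subst (_ ≤_) (sym (ℕ.+-identityʳ _)) unstable
legalSeq⇒threshold {n} {e} (_∷_ {i = i} _ legal) (i∉ks ∷ unique) {k} (there k∈ks) =
  subst (n ≤_) shift (legalSeq⇒threshold legal unique k∈ks)
  where
  shift : topple i e k + toℕ (index k∈ks) ≡ e k + suc (toℕ (index k∈ks))
  shift = trans (cong (_+ _) (topple-other e λ k≡i → All.lookup i∉ks k∈ks (sym k≡i)))
                (sym (ℕ.+-suc (e k) _))

threshold⇒legalSeq : ∀ {m n} {e : Config n} (h : Fin m → Fin n) → Injective _≡_ _≡_ h →
  (∀ p → n ≤ e (h p) + toℕ p) → LegalSeq e (tabulate h)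
threshold⇒legalSeq {zero} h _ _ = []
threshold⇒legalSeq {suc m} {n} {e} h h-inj threshold =
  subst (n ≤_) (ℕ.+-identityʳ _) (threshold Fin.zero) ∷
  threshold⇒legalSeq (h ∘ Fin.suc) (Fin.suc-injective ∘ h-inj) threshold'
  where
  threshold' : ∀ p → n ≤ topple (h Fin.zero) e (h (Fin.suc p)) + toℕ p
  threshold' p = subst (n ≤_) shift (threshold (Fin.suc p))
    where
    shift : e (h (Fin.suc p)) + suc (toℕ p) ≡ topple (h Fin.zero) e (h (Fin.suc p)) + toℕ p
    shift = trans (ℕ.+-suc _ _) (cong (_+ _) (sym (topple-other e λ hp≡h0 → 0≢1+n (h-inj (sym hp≡h0)))))

_≤ᵖ_ : ∀ {n} → (Fin n → Fin n) → Config n → Set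
π ≤ᵖ c = ∀ k → toℕ (π k) ≤ c k

-- For stable c this is equivalent to Rec c: it says that n − c is a parking function (Cori–Rossin).
DominatesPermutation : ∀ {n} → Config n → Set
DominatesPermutation {n} c = ∃ λ (π : Fin n → Fin n) → Injective _≡_ _≡_ π × π ≤ᵖ c

-- The vertex toppled at position p has received p grains before, so it holds n − 1 − p of its own.
rec⇒dominatesPermutation : ∀ {n} {c : Config n} → Rec c → DominatesPermutation c
rec⇒dominatesPermutation {n} {c} (_ , ks , legal , ks↭allFin) = π , π-inj , π≤c
  where
  unique : Unique ks
  unique = Unique-resp-↭ (setoid (Fin n)) (↭⇒↭ₛ (↭-sym ks↭allFin)) (allFin⁺ n)
  mem : ∀ k → k ∈ ks
  mem k = ∈-resp-↭ (↭-sym ks↭allFin) (∈-allFin k)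
  length≡n : length ks ≡ n
  length≡n = trans (↭-length ks↭allFin) (length-tabulate id)
  position : Fin n → Fin n
  position k = cast length≡n (index (mem k))
  π : Fin n → Fin n
  π = opposite ∘ position
  π-inj : Injective _≡_ _≡_ π
  π-inj {k} {k'} πk≡πk' = index-injective (setoid (Fin n)) (mem k) (mem k') (toℕ-injective (begin
    toℕ (index (mem k))   ≡⟨ toℕ-cast length≡n _ ⟨
    toℕ (position k)      ≡⟨ cong toℕ (opposite-injective πk≡πk') ⟩
    toℕ (position k')     ≡⟨ toℕ-cast length≡n _ ⟩
    toℕ (index (mem k'))  ∎))
    where open ≡-Reasoning
  π≤c : π ≤ᵖ c
  π≤c k = subst (_≤ c k) (sym toℕ-πk) (ℕ.m≤n+o⇒m∸n≤o n (suc p) (subst (n ≤_) rearrange threshold))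
    where
    p = toℕ (index (mem k))
    threshold : n ≤ suc (c k) + p
    threshold = legalSeq⇒threshold legal unique (mem k)
    rearrange : suc (c k) + p ≡ suc p + c k
    rearrange = cong suc (ℕ.+-comm (c k) p)
    toℕ-πk : toℕ (π k) ≡ n ∸ suc p
    toℕ-πk = trans (opposite-prop (position k)) (cong (λ x → n ∸ suc x) (toℕ-cast length≡n _))

-- Topple in decreasing order of π: the vertex with π = n − 1 − p comes p-th and then holds ≥ n grains.
stable-dominatesPermutation⇒rec : ∀ {n} {c : Config n} → Stable c → DominatesPermutation c → Rec c
stable-dominatesPermutation⇒rec {n} {c} stable (π , π-inj , π≤c) =
  stable , tabulate h , threshold⇒legalSeq h h-inj threshold , injective⇒tabulate↭allFin h-inj
  where
  π-surj = injective⇒surjective π-inj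
  h : Fin n → Fin n
  h p = proj₁ (π-surj (opposite p))
  πh≡opposite : ∀ p → π (h p) ≡ opposite p
  πh≡opposite p = proj₂ (π-surj (opposite p)) refl
  h-inj : Injective _≡_ _≡_ h
  h-inj {p} {p'} hp≡hp' = opposite-injective (begin
    opposite p   ≡⟨ πh≡opposite p ⟨
    π (h p)      ≡⟨ cong π hp≡hp' ⟩
    π (h p')     ≡⟨ πh≡opposite p' ⟩
    opposite p'  ∎)
    where open ≡-Reasoning
  threshold : ∀ p → n ≤ addOnes c (h p) + toℕ p
  threshold p = begin
    n                              ≡⟨ ℕ.m∸n+n≡m (toℕ<n p) ⟨
    n ∸ suc (toℕ p) + suc (toℕ p)  ≡⟨ ℕ.+-suc _ (toℕ p) ⟩
    suc (n ∸ suc (toℕ p) + toℕ p)  ≡⟨ cong (λ x → suc (x + toℕ p)) (opposite-prop p) ⟨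
    suc (toℕ (opposite p) + toℕ p) ≡⟨ cong (λ x → suc (toℕ x + toℕ p)) (πh≡opposite p) ⟨
    suc (toℕ (π (h p)) + toℕ p)    ≤⟨ ℕ.s≤s (ℕ.+-monoˡ-≤ (toℕ p) (π≤c (h p))) ⟩
    suc (c (h p) + toℕ p)          ∎
    where open ℕ.≤-Reasoning

asFin : ∀ {n} {c : Config n} → Stable c → Fin n → Fin n
asFin stable k = fromℕ< (stable k)

toℕ-asFin : ∀ {n} {c : Config n} (stable : Stable c) k → toℕ (asFin stable k) ≡ c k
toℕ-asFin stable k = toℕ-fromℕ< (stable k)

asFin-injective : ∀ {n} {c : Config n} (stable : Stable c) → Distinct c → Injective _≡_ _≡_ (asFin stable)
asFin-injective stable distinct {k} {k'} eq =
  distinct (trans (sym (toℕ-asFin stable k)) (trans (cong toℕ eq) (toℕ-asFin stable k')))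

distinct-stable⇒isPermutation : ∀ {n} {d : Config n} → Stable d → Distinct d → IsPermutation d
distinct-stable⇒isPermutation stable distinct =
  asFin stable , (δ-inj , injective⇒surjective δ-inj) , λ k → sym (toℕ-asFin stable k)
  where δ-inj = asFin-injective stable distinct

distinct-stable⇒minimalRec : ∀ {n} {d : Config n} → Stable d → Distinct d → MinimalRec d
distinct-stable⇒minimalRec {d = d} stable distinct =
  stable-dominatesPermutation⇒rec stable (asFin stable , δ-inj , ℕ.≤-reflexive ∘ toℕ-asFin stable) ,
  minimal
  where
  δ-inj = asFin-injective stable distinct
  minimal : ∀ d' → Rec d' → d' ≤ᶜ d → ∀ k → d' k ≡ d k
  minimal d' rec' d'≤d k with π , π-inj , π≤d' ← rec⇒dominatesPermutation rec' =
    ℕ.≤-antisym (d'≤d k) (begin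
      d k                   ≡⟨ toℕ-asFin stable k ⟨
      toℕ (asFin stable k)  ≡⟨ cong toℕ (π≡δ k) ⟨
      toℕ (π k)             ≤⟨ π≤d' k ⟩
      d' k                  ∎)
    where
    open ℕ.≤-Reasoning
    π≤δ : ∀ k → π k Fin.≤ asFin stable k
    π≤δ k = subst (toℕ (π k) ≤_) (sym (toℕ-asFin stable k)) (ℕ.≤-trans (π≤d' k) (d'≤d k))
    π≡δ = injections-≤-coincide π-inj δ-inj π≤δ

update-≤ᵖ : ∀ {n} {π : Fin n → Fin n} {c : Config n} {i v} →
  π ≤ᵖ c → toℕ (π i) ≤ v → π ≤ᵖ (c [ i ≔ v ])
update-≤ᵖ {i = i} π≤c πi≤v k with k ≟ i
... | yes refl = πi≤v
... | no _ = π≤c k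

transpose-≤ᵖ : ∀ {n} {π : Fin n → Fin n} {c : Config n} {i j} →
  (∀ k → k ≢ i → k ≢ j → toℕ (π k) ≤ c k) →
  toℕ (π j) ≤ c i → toℕ (π i) ≤ c j → (π ∘ transpose i j) ≤ᵖ c
transpose-≤ᵖ {π = π} {c} {i} {j} π≤c πj≤ci πi≤cj k = byCases (k ≟ i) (k ≟ j)
  where
  byCases : Dec (k ≡ i) → Dec (k ≡ j) → toℕ (π (transpose i j k)) ≤ c k
  byCases (yes refl) _ rewrite transpose-matchˡ k j = πj≤ci
  byCases (no _) (yes refl) rewrite transpose-matchʳ i k = πi≤cj
  byCases (no k≢i) (no k≢j) rewrite transpose-other k≢i k≢j = π≤c k k≢i k≢j

duplicate-nonzero : ∀ {n} {c : Config n} {i j} →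
  DominatesPermutation c → j ≢ i → c j ≡ c i → c i ≢ 0
duplicate-nonzero {c = c} {i} {j} (π , π-inj , π≤c) j≢i cj≡ci ci≡0 =
  j≢i (π-inj (toℕ-injective (trans (ℕ.n≤0⇒n≡0 πj≤0) (sym (ℕ.n≤0⇒n≡0 πi≤0)))))
  where
  πi≤0 : toℕ (π i) ≤ 0
  πi≤0 = subst (toℕ (π i) ≤_) ci≡0 (π≤c i)
  πj≤0 : toℕ (π j) ≤ 0
  πj≤0 = subst (toℕ (π j) ≤_) (trans cj≡ci ci≡0) (π≤c j)

-- If π i no longer fits below the lowered entry, then π i = c i = c j > π j: exchange π i and π j.
decrement-dominatesPermutation : ∀ {n} {c : Config n} {i j s} →
  DominatesPermutation c → j ≢ i → c j ≡ c i → c i ≡ suc s →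
  DominatesPermutation (c [ i ≔ s ])
decrement-dominatesPermutation {c = c} {i} {j} {s} (π , π-inj , π≤c) j≢i cj≡ci ci≡1+s
  with toℕ (π i) ℕ.≤? s
... | yes πi≤s = π , π-inj , update-≤ᵖ π≤c πi≤s
... | no πi≰s = π ∘ transpose i j , transpose-injective i j ∘ π-inj ,
  transpose-≤ᵖ others (ℕ.≤-trans πj≤s (ℕ.≤-reflexive (sym (update-same c i s))))
                      (subst (toℕ (π i) ≤_) (sym (update-other c s j≢i))
                        (ℕ.≤-reflexive (trans πi≡1+s (trans (sym ci≡1+s) (sym cj≡ci)))))
  where
  πi≡1+s : toℕ (π i) ≡ suc s
  πi≡1+s = ℕ.≤-antisym (subst (toℕ (π i) ≤_) ci≡1+s (π≤c i)) (ℕ.≰⇒> πi≰s)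
  πj≤s : toℕ (π j) ≤ s
  πj≤s with ℕ.m≤n⇒m<n∨m≡n (subst (toℕ (π j) ≤_) (trans cj≡ci ci≡1+s) (π≤c j))
  ... | inj₁ πj<1+s = ℕ.≤-pred πj<1+s
  ... | inj₂ πj≡1+s = contradiction (π-inj (toℕ-injective (trans πj≡1+s (sym πi≡1+s)))) j≢i
  others : ∀ k → k ≢ i → k ≢ j → toℕ (π k) ≤ (c [ i ≔ s ]) k
  others k k≢i _ = subst (toℕ (π k) ≤_) (sym (update-other c s k≢i)) (π≤c k)

lower-exists : ∀ {n} (i j : Fin n) (c : Config n) → DominatesPermutation c → ∃ (Lower i j c)
lower-exists i j c dom = lowerFrom (c i) c refl dom
  where
  lowerFrom : ∀ v c → c i ≡ v → DominatesPermutation c → ∃ (Lower i j c)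
  lowerFrom v c ci≡v dom
    with any? (λ j' → (toℕ j' ℕ.≤? toℕ j) ×-dec ¬? (j' ≟ i) ×-dec (c j' ℕ.≟ c i))
  ... | no ∄j' = c , stop λ j' j'≤j j'≢i cj'≡ci → ∄j' (j' , j'≤j , j'≢i , cj'≡ci)
  lowerFrom zero c ci≡0 dom | yes (j' , _ , j'≢i , cj'≡ci) =
    contradiction ci≡0 (duplicate-nonzero dom j'≢i cj'≡ci)
  lowerFrom (suc s) c ci≡1+s dom | yes (j' , j'≤j , j'≢i , cj'≡ci) =
    map₂ (dec j' j'≤j j'≢i cj'≡ci ci≡1+s)
         (lowerFrom s (c [ i ≔ s ]) (update-same c i s) (decrement-dominatesPermutation dom j'≢i cj'≡ci ci≡1+s))

lower-preserves-dominatesPermutation : ∀ {n} {i j : Fin n} {c d} →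
  Lower i j c d → DominatesPermutation c → DominatesPermutation d
lower-preserves-dominatesPermutation (stop _) dom = dom
lower-preserves-dominatesPermutation (dec j' _ j'≢i cj'≡ci ci≡1+s lower) dom =
  lower-preserves-dominatesPermutation lower (decrement-dominatesPermutation dom j'≢i cj'≡ci ci≡1+s)

lower-≤ᶜ : ∀ {n} {i j : Fin n} {c d} → Lower i j c d → d ≤ᶜ c
lower-≤ᶜ (stop _) k = ℕ.≤-refl
lower-≤ᶜ {c = c} (dec _ _ _ _ ci≡1+s lower) k =
  ℕ.≤-trans (lower-≤ᶜ lower k) (update-≤ᶜ c (ℕ.≤-trans (ℕ.n≤1+n _) (ℕ.≤-reflexive (sym ci≡1+s))) k)

lower-decreases : ∀ {n} {i j : Fin n} {c d} → FirstDuplicate c i j → Lower i j c d → d i < c i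
-- The loop body runs at least once, since j itself duplicates the entry at i.
lower-decreases {j = j} (i<j , ci≡cj , _) (stop no-duplicate) =
  contradiction (sym ci≡cj) (no-duplicate j ℕ.≤-refl λ j≡i → ℕ.<-irrefl (cong toℕ (sym j≡i)) i<j)
lower-decreases {i = i} {c = c} _ (dec {v = s} _ _ _ _ ci≡1+s lower) = begin-strict
  _                ≤⟨ lower-≤ᶜ lower i ⟩
  (c [ i ≔ s ]) i  ≡⟨ update-same c i s ⟩
  s                <⟨ ℕ.n<1+n s ⟩
  suc s            ≡⟨ sym ci≡1+s ⟩
  c i              ∎
  where open ℕ.≤-Reasoning

RepeatsEarlier : ∀ {n} → Config n → Fin n → Set
RepeatsEarlier c j = ∃ λ i → toℕ i < toℕ j × c i ≡ c j

repeatsEarlier? : ∀ {n} (c : Config n) → Decidable (RepeatsEarlier c)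
repeatsEarlier? c j = any? λ i → (toℕ i ℕ.<? toℕ j) ×-dec (c i ℕ.≟ c j)

noneRepeatsEarlier⇒distinct : ∀ {n} {c : Config n} → (∀ j → ¬ RepeatsEarlier c j) → Distinct c
noneRepeatsEarlier⇒distinct none {a} {b} ca≡cb with ℕ.<-cmp (toℕ a) (toℕ b)
... | tri< a<b _ _ = contradiction (a , a<b , ca≡cb) (none b)
... | tri≈ _ a≡b _ = toℕ-injective a≡b
... | tri> _ _ b<a = contradiction (b , b<a , sym ca≡cb) (none a)

distinct-or-firstDuplicate : ∀ {n} (c : Config n) → Distinct c ⊎ ∃₂ (FirstDuplicate c)
distinct-or-firstDuplicate c with all? (¬? ∘ repeatsEarlier? c)
... | yes none = inj₁ (noneRepeatsEarlier⇒distinct none)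
... | no some with ¬∀⟶∃¬-smallest _ _ (¬? ∘ repeatsEarlier? c) some
... | j , ¬¬repeats , earlierDistinct with decidable-stable (repeatsEarlier? c j) ¬¬repeats
... | i , i<j , ci≡cj = inj₂ (i , j , i<j , ci≡cj , least)
  where
  least : ∀ j' i' → toℕ j' < toℕ j → toℕ i' < toℕ j' → c i' ≢ c j'
  least j' i' j'<j i'<j' ci'≡cj' = earlierDistinct k (subst (RepeatsEarlier c) (sym inject-k≡j') (i' , i'<j' , ci'≡cj'))
    where
    k = fromℕ< j'<j
    inject-k≡j' : inject k ≡ j'
    inject-k≡j' = toℕ-injective (trans (toℕ-inject k) (toℕ-fromℕ< j'<j))

grains : ∀ {n} → Config n → ℕ
grains {zero} c = 0
grains {suc n} c = c Fin.zero + grains (c ∘ Fin.suc)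

grains-mono-≤ : ∀ {n} {c d : Config n} → d ≤ᶜ c → grains d ≤ grains c
grains-mono-≤ {zero} d≤c = ℕ.z≤n
grains-mono-≤ {suc n} d≤c = ℕ.+-mono-≤ (d≤c Fin.zero) (grains-mono-≤ (d≤c ∘ Fin.suc))

grains-mono-< : ∀ {n} {c d : Config n} → d ≤ᶜ c → ∀ i → d i < c i → grains d < grains c
grains-mono-< d≤c Fin.zero di<ci = ℕ.+-mono-<-≤ di<ci (grains-mono-≤ (d≤c ∘ Fin.suc))
grains-mono-< d≤c (Fin.suc i) di<ci = ℕ.+-mono-≤-< (d≤c Fin.zero) (grains-mono-< (d≤c ∘ Fin.suc) i di<ci)

reduce-exists : ∀ {n} (c : Config n) → DominatesPermutation c → ∃ (Reduce c)
reduce-exists c = reduceFrom c (ℕ.<-wellFounded (grains c))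
  where
  reduceFrom : ∀ c → Acc _<_ (grains c) → DominatesPermutation c → ∃ (Reduce c)
  reduceFrom c (acc smaller) dom with distinct-or-firstDuplicate c
  ... | inj₁ distinct = c , finish distinct
  ... | inj₂ (i , j , firstDup) with lower-exists i j c dom
  ... | c' , lower = map₂ (step i j firstDup lower)
    (reduceFrom c' (smaller (grains-mono-< (lower-≤ᶜ lower) i (lower-decreases firstDup lower)))
                   (lower-preserves-dominatesPermutation lower dom))

stable-≤ᶜ : ∀ {n} {c d : Config n} → d ≤ᶜ c → Stable c → Stable d
stable-≤ᶜ d≤c c-stable k = ℕ.≤-<-trans (d≤c k) (c-stable k)

reduce-≤ᶜ : ∀ {n} {c d : Config n} → Reduce c d → d ≤ᶜ c
reduce-≤ᶜ (finish _) k = ℕ.≤-refl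
reduce-≤ᶜ (step _ _ _ lower reduce) k = ℕ.≤-trans (reduce-≤ᶜ reduce k) (lower-≤ᶜ lower k)

reduce-distinct : ∀ {n} {c d : Config n} → Reduce c d → Distinct d
reduce-distinct (finish distinct) = distinct
reduce-distinct (step _ _ _ _ reduce) = reduce-distinct reduce

proposition5p8 : (n : ℕ) → 1 ≤ n → (c : Config n) → Rec c →
    (∃ λ d → Reduce c d) ×
    (∀ d → Reduce c d → IsPermutation d × MinimalRec d)
proposition5p8 n _ c rec@(c-stable , _) =
  reduce-exists c (rec⇒dominatesPermutation rec) ,
  λ d c↝d →
    let d-stable = stable-≤ᶜ (reduce-≤ᶜ c↝d) c-stable
        d-distinct = reduce-distinct c↝d
    in distinct-stable⇒isPermutation d-stable d-distinct , distinct-stable⇒minimalRec d-stable d-distinct
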